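{- Let $K\ge1$, $m=2^K-1$ and $B=2^{2^K}$. Then the factor complexity of the infinite word $a_m(0)a_m(1)a_m(2)\cdots$ satisfies $p_{a_m}(n)=2n$ for all $1\le n\le B+1$.
   Context: For $n\ge0$ write $b_p(n)=\lfloor n/2^p\rfloor\bmod 2$; $\oplus$ is XOR and $\&$ is bitwise AND. For $m\ge0$, $a_m(n)=\bigoplus_{p\ge0,\ p\,\&\,m=0} b_p(n)$. For an infinite word $w$, $p_w(n)$ denotes the number of distinct factors (contiguous finite subwords) of $w$ of length $n$. -}

module Defs where

open import Data.Nat using (ℕ; zero; suc; _+_; _^_; _≡ᵇ_)
open import Data.Nat.DivMod using (_/_; _%_)
open import Data.Bool using (Bool; true; false; _xor_; _∧_; not; if_then_else_)
open import Data.List using (List; upTo; foldr; map; length)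
open import Data.Bool.ListAction using (and)
open import Data.Nat.Properties using (m^n≢0)
open import Data.List.Relation.Unary.Unique.Propositional using (Unique)
open import Data.List.Membership.Propositional using (_∈_)
open import Data.Vec using (Vec; tabulate)
open import Data.Fin using (Fin; toℕ)
open import Data.Product using (Σ; _×_; ∃)
open import Function.Bundles using (_⇔_)
open import Relation.Binary.PropositionalEquality using (_≡_)

bit : ℕ → ℕ → Bool
bit p n = ((_/_ n (2 ^ p) {{m^n≢0 2 p}}) % 2) ≡ᵇ 1

-- p & m = 0 : no position q has bit q of both p and m equal to 1.
-- Positions q > p need not be checked since bit q p = 0 there (2^q > p).
andZero : ℕ → ℕ → Bool
andZero p m = and (map (λ q → not (bit q p ∧ bit q m)) (upTo (suc p)))

-- a_m(n) = XOR over p ≥ 0 with p & m = 0 of b_p(n).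
-- Only p ≤ n can contribute, since b_p(n) = 0 when p > n (2^p > n).
a : ℕ → ℕ → Bool
a m n = foldr (λ p acc → (if andZero p m then bit p n else false) xor acc) false (upTo (suc n))

factor : (ℕ → Bool) → ℕ → (n : ℕ) → Vec Bool n
factor w i n = tabulate (λ (j : Fin n) → w (i + toℕ j))

FactorComplexity : (ℕ → Bool) → ℕ → ℕ → Set
FactorComplexity w n k =
  Σ (List (Vec Bool n)) λ L →
    Unique L × length L ≡ k × (∀ u → (u ∈ L) ⇔ (∃ λ i → factor w i n ≡ u))

-- For m = 2^K − 1 the condition p & m = 0 means 2^K ∣ p, so a_m(n) is the parity of the
-- binary digits of n at the positions divisible by D = 2^K. Splitting off the lowest D digits
-- gives a_m(r + qB) = a_m(q) ⊕ (r mod 2) for r < B = 2^D: the word is a concatenation of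
-- alternating blocks of length B, so two equal consecutive letters only occur across a block
-- boundary, and any two such repeats are at least B apart. A factor of length n ≤ B + 1
-- therefore contains at most one repeat and is determined by its first letter and the
-- position d ∈ {1, …, n} of the repeat (d = n if there is none). Conversely all 2n of these
-- words occur, around the boundaries after blocks 0 and 1 (which carry a repeat) and after
-- block B − 1 (which does not).

module Submission where

open import Data.Bool using (Bool; true; false; not; _∧_; _xor_; if_then_else_) renaming (_≟_ to _≟ᵇ_)
open import Data.Bool.Properties
  using ( not-involutive; not-distribˡ-xor; not-distribʳ-xor; not-¬; ¬-not; true-xor; xor-same; xor-comm
        ; xor-assoc; xor-identityʳ; ∧-zeroʳ; ∧-identityʳ)
open import Data.Bool.ListAction using (and)
open import Data.List using (List; applyUpTo; foldr; map; length; _++_)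
open import Data.List.Properties using (length-++; length-applyUpTo)
open import Data.List.Membership.Propositional using (_∈_)
open import Data.List.Membership.Propositional.Properties
  using (∈-++⁺ˡ; ∈-++⁺ʳ; ∈-++⁻; ∈-applyUpTo⁺; ∈-applyUpTo⁻)
open import Data.List.Relation.Binary.Disjoint.Propositional using (Disjoint)
open import Data.List.Relation.Unary.Unique.Propositional using (Unique)
open import Data.List.Relation.Unary.Unique.Propositional.Properties using (++⁺; applyUpTo⁺₁)
open import Data.Vec using (Vec; tabulate; lookup; head)
open import Data.Vec.Properties using (lookup∘tabulate; tabulate-cong)
open import Data.Fin using (toℕ; fromℕ<)
open import Data.Fin.Properties using (toℕ<n; toℕ-fromℕ<)
open import Data.Product using (_×_; _,_; ∃; ∃₂; map₂)
open import Data.Nat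
  using (ℕ; zero; suc; _+_; _*_; _∸_; _^_; _≤_; _<_; _≡ᵇ_; z≤n; s≤s; s≤s⁻¹; z<s; s<s; NonZero; >-nonZero)
open import Data.Nat.DivMod
open import Data.Nat.Divisibility using (_∣_; divides; n∣m*n)
open import Data.Nat.Properties
open import Algebra.Properties.CommutativeSemigroup +-commutativeSemigroup using (xy∙z≈xz∙y)
open import Data.Nat.Tactic.RingSolver using (solve-∀)
open import Data.Sum using (inj₁; inj₂)
open import Relation.Binary.PropositionalEquality
open import Function.Base using (_∘_)
open import Relation.Nullary using (contradiction; does; yes; no)
open import Relation.Nullary.Decidable using (dec-true; dec-false; does-⇔)
open import Function.Bundles using (mk⇔)
open import Defs

2^-nonZero : ∀ p → NonZero (2 ^ p)
2^-nonZero p = m^n≢0 2 p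

infixl 7 _>>_
_>>_ : ℕ → ℕ → ℕ
n >> o = _/_ n (2 ^ o) {{2^-nonZero o}}

n<2^n : ∀ n → n < 2 ^ n
n<2^n zero = z<s
n<2^n (suc n) = subst (_≤ 2 * 2 ^ n) (+-comm (suc n) 1)
  (+-mono-≤ (n<2^n n) (subst (1 ≤_) (sym (+-identityʳ (2 ^ n))) (m^n>0 2 n)))

n<2^1+n : ∀ n → n < 2 ^ suc n
n<2^1+n n = <-≤-trans (n<2^n n) (^-monoʳ-≤ 2 (n≤1+n n))

[m+kn]/n≡k : ∀ m k n .{{_ : NonZero n}} → m < n → (m + k * n) / n ≡ k
[m+kn]/n≡k m k n m<n = begin
  (m + k * n) / n     ≡⟨ +-distrib-/-∣ʳ m (n∣m*n k) ⟩
  m / n + k * n / n   ≡⟨ cong₂ _+_ (m<n⇒m/n≡0 m<n) (m*n/n≡m k n) ⟩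
  k                   ∎
  where open ≡-Reasoning

2^1+K∸1≡1+[2^K∸1]*2 : ∀ K → 2 ^ suc K ∸ 1 ≡ 1 + (2 ^ K ∸ 1) * 2
2^1+K∸1≡1+[2^K∸1]*2 K = begin
  2 * 2 ^ K ∸ 1              ≡⟨ cong (λ k → 2 * k ∸ 1) (sym (m+[n∸m]≡n (m^n>0 2 K))) ⟩
  2 * suc (2 ^ K ∸ 1) ∸ 1    ≡⟨ double-suc∸1 (2 ^ K ∸ 1) ⟩
  1 + (2 ^ K ∸ 1) * 2        ∎
  where
    open ≡-Reasoning
    double-suc∸1 : ∀ e → e + suc (e + 0) ≡ 1 + e * 2
    double-suc∸1 = solve-∀

∣-gap : ∀ {m x y} → m ∣ x → m ∣ y → x < y → m + x ≤ y
∣-gap {m} (divides p refl) (divides q refl) pm<qm = *-monoˡ-≤ m (*-cancelʳ-< m p q pm<qm)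

-- Parity and binary digits

odd : ℕ → Bool
odd zero = false
odd (suc n) = not (odd n)

odd-+ : ∀ m n → odd (m + n) ≡ odd m xor odd n
odd-+ zero n = refl
odd-+ (suc m) n = trans (cong not (odd-+ m n)) (not-distribˡ-xor (odd m) (odd n))

odd-*2 : ∀ n → odd (n * 2) ≡ false
odd-*2 n = begin
  odd (n * 2)        ≡⟨ cong odd (*-comm n 2) ⟩
  odd (n + (n + 0))  ≡⟨ cong (λ k → odd (n + k)) (+-identityʳ n) ⟩
  odd (n + n)        ≡⟨ odd-+ n n ⟩
  odd n xor odd n    ≡⟨ xor-same (odd n) ⟩
  false              ∎
  where open ≡-Reasoning

odd-*-2^suc : ∀ t K → odd (t * 2 ^ suc K) ≡ false
odd-*-2^suc t K = trans (cong odd (*-2* t (2 ^ K))) (odd-*2 (t * 2 ^ K))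
  where
    *-2* : ∀ t m → t * (2 * m) ≡ t * m * 2
    *-2* = solve-∀

odd-*-2^2^ : ∀ q K → odd (q * 2 ^ 2 ^ K) ≡ false
odd-*-2^2^ q K =
  trans (cong (λ p → odd (q * 2 ^ p)) (sym (m+[n∸m]≡n (m^n>0 2 K)))) (odd-*-2^suc q (2 ^ K ∸ 1))

xor-cancelʳ : ∀ b c → (b xor c) xor c ≡ b
xor-cancelʳ b c = trans (xor-assoc b c c) (trans (cong (b xor_) (xor-same c)) (xor-identityʳ b))

odd≡[%2≡ᵇ1] : ∀ n → (n % 2 ≡ᵇ 1) ≡ odd n
odd≡[%2≡ᵇ1] zero = refl
odd≡[%2≡ᵇ1] (suc zero) = refl
odd≡[%2≡ᵇ1] (suc (suc n)) = trans (odd≡[%2≡ᵇ1] n) (sym (not-involutive (odd n)))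

bit-zero : ∀ n → bit 0 n ≡ odd n
bit-zero n = trans (cong (λ k → k % 2 ≡ᵇ 1) (n/1≡n n)) (odd≡[%2≡ᵇ1] n)

>>-suc : ∀ n o → n >> o / 2 ≡ n >> suc o
>>-suc n o = trans (m/n/o≡m/[n*o] n (2 ^ o) 2 {{2^-nonZero o}} {{_}} {{nz}})
                   (/-congʳ {{nz}} {{2^-nonZero (suc o)}} (*-comm (2 ^ o) 2))
  where nz = m*n≢0 (2 ^ o) 2 {{2^-nonZero o}}

bit-+ : ∀ o j n → bit (o + j) n ≡ bit j (n >> o)
bit-+ o j n = cong (λ k → k % 2 ≡ᵇ 1) (begin
  n >> (o + j)             ≡⟨ /-congʳ {{2^-nonZero (o + j)}} {{nz}} (^-distribˡ-+-* 2 o j) ⟩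
  _/_ n (2 ^ o * 2 ^ j) {{nz}} ≡⟨ sym (m/n/o≡m/[n*o] n (2 ^ o) (2 ^ j) {{2^-nonZero o}} {{2^-nonZero j}} {{nz}}) ⟩
  n >> o >> j              ∎)
  where
    open ≡-Reasoning
    nz = m*n≢0 (2 ^ o) (2 ^ j) {{2^-nonZero o}} {{2^-nonZero j}}

/2->> : ∀ n o → n / 2 >> o ≡ n >> suc o
/2->> n o = m/n/o≡m/[n*o] n 2 (2 ^ o) {{_}} {{2^-nonZero o}} {{2^-nonZero (suc o)}}

-- Masked binary digit parity

maskedParity : (ℕ → Bool) → ℕ → ℕ → Bool
maskedParity c zero n = false
maskedParity c (suc L) n = (c 0 ∧ odd n) xor maskedParity (λ p → c (suc p)) L (n / 2)

maskedParity-cong : ∀ {c c'} L n → (∀ p → c p ≡ c' p) → maskedParity c L n ≡ maskedParity c' L n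
maskedParity-cong zero n c≗c' = refl
maskedParity-cong (suc L) n c≗c' =
  cong₂ (λ b r → (b ∧ odd n) xor r) (c≗c' 0) (maskedParity-cong L (n / 2) (λ p → c≗c' (suc p)))

maskedParity-false : ∀ c L n → (∀ p → p < L → c p ≡ false) → maskedParity c L n ≡ false
maskedParity-false c zero n c≡false = refl
maskedParity-false c (suc L) n c≡false =
  cong₂ (λ b r → (b ∧ odd n) xor r) (c≡false 0 z<s)
        (maskedParity-false _ L (n / 2) (λ p p<L → c≡false (suc p) (s<s p<L)))

xorFold≡maskedParity : ∀ c L {h} o n → (∀ j → h j ≡ o + j) →
  foldr (λ p acc → (if c p then bit p n else false) xor acc) false (applyUpTo h L)
    ≡ maskedParity (λ j → c (o + j)) L (n >> o)
xorFold≡maskedParity c zero o n h≗ = refl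
xorFold≡maskedParity c (suc L) {h} o n h≗ = cong₂ _xor_ head-term tail-fold
  where
    if≡∧ : ∀ b x → (if b then x else false) ≡ (b ∧ x)
    if≡∧ true x = refl
    if≡∧ false x = refl
    head-term : (if c (h 0) then bit (h 0) n else false) ≡ (c (o + 0) ∧ odd (n >> o))
    head-term = begin
      (if c (h 0) then bit (h 0) n else false) ≡⟨ if≡∧ (c (h 0)) (bit (h 0) n) ⟩
      c (h 0) ∧ bit (h 0) n                     ≡⟨ cong (λ p → c p ∧ bit p n) (h≗ 0) ⟩
      c (o + 0) ∧ bit (o + 0) n                 ≡⟨ cong (c (o + 0) ∧_) (trans (bit-+ o 0 n) (bit-zero (n >> o))) ⟩
      c (o + 0) ∧ odd (n >> o)                  ∎
      where open ≡-Reasoning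
    tail-fold : foldr (λ p acc → (if c p then bit p n else false) xor acc) false (applyUpTo (λ j → h (suc j)) L)
                ≡ maskedParity (λ j → c (o + suc j)) L (n >> o / 2)
    tail-fold = begin
      foldr _ false (applyUpTo (λ j → h (suc j)) L)
        ≡⟨ xorFold≡maskedParity c L (suc o) n (λ j → trans (h≗ (suc j)) (+-suc o j)) ⟩
      maskedParity (λ j → c (suc o + j)) L (n >> suc o)
        ≡⟨ maskedParity-cong L _ (λ j → cong c (sym (+-suc o j))) ⟩
      maskedParity (λ j → c (o + suc j)) L (n >> suc o)
        ≡⟨ cong (maskedParity _ L) (sym (>>-suc n o)) ⟩
      maskedParity (λ j → c (o + suc j)) L (n >> o / 2)
        ∎
      where open ≡-Reasoning

a≡maskedParity : ∀ m n → a m n ≡ maskedParity (λ p → andZero p m) (suc n) n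
a≡maskedParity m n = trans (xorFold≡maskedParity (λ p → andZero p m) (suc n) 0 n (λ _ → refl))
                           (cong (maskedParity (λ p → andZero p m) (suc n)) (n/1≡n n))

maskedParity-suc : ∀ c L n → n < 2 ^ L → maskedParity c (suc L) n ≡ maskedParity c L n
maskedParity-suc c zero zero _ = cong (_xor false) (∧-zeroʳ (c 0))
maskedParity-suc c zero (suc n) (s<s ())
maskedParity-suc c (suc L) n n<2^L =
  cong ((c 0 ∧ odd n) xor_) (maskedParity-suc _ L (n / 2) (m<n*o⇒m/o<n (subst (n <_) (*-comm 2 (2 ^ L)) n<2^L)))

maskedParity-+ˡ : ∀ c k L n → n < 2 ^ L → maskedParity c (k + L) n ≡ maskedParity c L n
maskedParity-+ˡ c zero L n n<2^L = refl
maskedParity-+ˡ c (suc k) L n n<2^L =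
  trans (maskedParity-suc c (k + L) n (<-≤-trans n<2^L (^-monoʳ-≤ 2 (m≤n+m L k))))
        (maskedParity-+ˡ c k L n n<2^L)

maskedParity-stable : ∀ c L L' n → n < 2 ^ L → n < 2 ^ L' → maskedParity c L n ≡ maskedParity c L' n
maskedParity-stable c L L' n n<2^L n<2^L' with ≤-total L L'
... | inj₁ L≤L' =
  trans (sym (maskedParity-+ˡ c (L' ∸ L) L n n<2^L)) (cong (λ k → maskedParity c k n) (m∸n+n≡m L≤L'))
... | inj₂ L'≤L =
  trans (cong (λ k → maskedParity c k n) (sym (m∸n+n≡m L'≤L))) (maskedParity-+ˡ c (L ∸ L') L' n n<2^L')

maskedParity-+ : ∀ c o L n →
  maskedParity c (o + L) n ≡ maskedParity c o n xor maskedParity (λ j → c (o + j)) L (n >> o)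
maskedParity-+ c zero L n = cong (maskedParity c L) (sym (n/1≡n n))
maskedParity-+ c (suc o) L n = begin
  (c 0 ∧ odd n) xor maskedParity c' (o + L) (n / 2)
    ≡⟨ cong ((c 0 ∧ odd n) xor_) (maskedParity-+ c' o L (n / 2)) ⟩
  (c 0 ∧ odd n) xor (maskedParity c' o (n / 2) xor maskedParity (λ j → c (suc o + j)) L (n / 2 >> o))
    ≡⟨ sym (xor-assoc (c 0 ∧ odd n) _ _) ⟩
  maskedParity c (suc o) n xor maskedParity (λ j → c (suc o + j)) L (n / 2 >> o)
    ≡⟨ cong (maskedParity c (suc o) n xor_) (cong (maskedParity _ L) (/2->> n o)) ⟩
  maskedParity c (suc o) n xor maskedParity (λ j → c (suc o + j)) L (n >> suc o)
    ∎
  where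
    open ≡-Reasoning
    c' = λ p → c (suc p)

-- The mask 2^K − 1

infix 4 2^_∣ᵇ_
2^_∣ᵇ_ : ℕ → ℕ → Bool
2^ K ∣ᵇ x = _%_ x (2 ^ K) {{2^-nonZero K}} ≡ᵇ 0

2^suc-∣ᵇ : ∀ K x → (2^ suc K ∣ᵇ x) ≡ not (odd x) ∧ (2^ K ∣ᵇ x / 2)
2^suc-∣ᵇ K x with x % 2 | m%n<n x 2 | odd≡[%2≡ᵇ1] x | m≡m%n+[m/n]*n x 2
... | 0 | _ | even-x | x≡ = begin
  (_%_ x (2 ^ suc K) {{nz}} ≡ᵇ 0)          ≡⟨ cong (_≡ᵇ 0) low-bits ⟩
  (_%_ (x / 2) (2 ^ K) {{2^-nonZero K}} * 2 ≡ᵇ 0)  ≡⟨ *2≡ᵇ0 (_%_ (x / 2) (2 ^ K) {{2^-nonZero K}}) ⟩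
  (2^ K ∣ᵇ x / 2)                           ≡⟨ cong (λ b → not b ∧ (2^ K ∣ᵇ x / 2)) even-x ⟩
  not (odd x) ∧ (2^ K ∣ᵇ x / 2)             ∎
  where
    open ≡-Reasoning
    nz = 2^-nonZero (suc K)
    nz' = m*n≢0 (2 ^ K) 2 {{2^-nonZero K}}
    *2≡ᵇ0 : ∀ v → (v * 2 ≡ᵇ 0) ≡ (v ≡ᵇ 0)
    *2≡ᵇ0 zero = refl
    *2≡ᵇ0 (suc v) = refl
    low-bits : _%_ x (2 ^ suc K) {{nz}} ≡ _%_ (x / 2) (2 ^ K) {{2^-nonZero K}} * 2
    low-bits = begin
      _%_ x (2 ^ suc K) {{nz}}                   ≡⟨ cong (λ y → _%_ y (2 ^ suc K) {{nz}}) x≡ ⟩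
      _%_ (x / 2 * 2) (2 ^ suc K) {{nz}}         ≡⟨ %-congʳ {{nz}} {{nz'}} (*-comm 2 (2 ^ K)) ⟩
      _%_ (x / 2 * 2) (2 ^ K * 2) {{nz'}}        ≡⟨ sym (m%n*o≡m*o%[n*o] (x / 2) (2 ^ K) 2 {{2^-nonZero K}} {{nz'}}) ⟩
      _%_ (x / 2) (2 ^ K) {{2^-nonZero K}} * 2   ∎
... | 1 | _ | odd-x | _ = trans (remainder-nonzero _ refl) (cong (λ b → not b ∧ (2^ K ∣ᵇ x / 2)) odd-x)
  where
    nz = 2^-nonZero (suc K)
    remainder-nonzero : ∀ r → r ≡ _%_ x (2 ^ suc K) {{nz}} → (r ≡ᵇ 0) ≡ false
    remainder-nonzero zero r≡0 = contradiction (trans odd-x (trans (cong odd x≡t*2^suc) (odd-*-2^suc t K))) λ ()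
      where
        t = _/_ x (2 ^ suc K) {{nz}}
        x≡t*2^suc : x ≡ t * 2 ^ suc K
        x≡t*2^suc = trans (m≡m%n+[m/n]*n x (2 ^ suc K) {{nz}}) (cong (_+ t * 2 ^ suc K) (sym r≡0))
    remainder-nonzero (suc r) _ = refl
... | suc (suc _) | s≤s (s≤s ()) | _ | _

disjoint : ℕ → ℕ → ℕ → Bool
disjoint zero x y = true
disjoint (suc L) x y = not (odd x ∧ odd y) ∧ disjoint L (x / 2) (y / 2)

andFold≡disjoint : ∀ L {h} o x y → (∀ j → h j ≡ o + j) →
  and (map (λ q → not (bit q x ∧ bit q y)) (applyUpTo h L)) ≡ disjoint L (x >> o) (y >> o)
andFold≡disjoint zero o x y h≗ = refl
andFold≡disjoint (suc L) {h} o x y h≗ = cong₂ _∧_ head-term tail-fold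
  where
    bit-h0 : ∀ z → bit (h 0) z ≡ odd (z >> o)
    bit-h0 z = trans (cong (λ q → bit q z) (h≗ 0)) (trans (bit-+ o 0 z) (bit-zero (z >> o)))
    head-term : not (bit (h 0) x ∧ bit (h 0) y) ≡ not (odd (x >> o) ∧ odd (y >> o))
    head-term = cong₂ (λ u v → not (u ∧ v)) (bit-h0 x) (bit-h0 y)
    tail-fold : and (map (λ q → not (bit q x ∧ bit q y)) (applyUpTo (λ j → h (suc j)) L))
                ≡ disjoint L (x >> o / 2) (y >> o / 2)
    tail-fold = trans (andFold≡disjoint L (suc o) x y (λ j → trans (h≗ (suc j)) (+-suc o j)))
                      (sym (cong₂ (disjoint L) (>>-suc x o) (>>-suc y o)))

disjoint-zeroʳ : ∀ L x → disjoint L x 0 ≡ true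
disjoint-zeroʳ zero x = refl
disjoint-zeroʳ (suc L) x =
  trans (cong (λ b → not b ∧ disjoint L (x / 2) 0) (∧-zeroʳ (odd x))) (disjoint-zeroʳ L (x / 2))

disjoint-2^∸1 : ∀ K L x → x < 2 ^ L → disjoint L x (2 ^ K ∸ 1) ≡ (2^ K ∣ᵇ x)
disjoint-2^∸1 zero L x _ = trans (disjoint-zeroʳ L x) (cong (_≡ᵇ 0) (sym (n%1≡0 x)))
disjoint-2^∸1 (suc K) zero zero _ = cong (_≡ᵇ 0) (sym (m<n⇒m%n≡m {{2^-nonZero (suc K)}} (m^n>0 2 (suc K))))
disjoint-2^∸1 (suc K) zero (suc x) (s<s ())
disjoint-2^∸1 (suc K) (suc L) x x<2^L = begin
  not (odd x ∧ odd ones) ∧ disjoint L (x / 2) (ones / 2)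
    ≡⟨ cong₂ (λ u v → not (odd x ∧ u) ∧ disjoint L (x / 2) v) odd-ones ones/2 ⟩
  not (odd x ∧ true) ∧ disjoint L (x / 2) (2 ^ K ∸ 1)
    ≡⟨ cong₂ (λ u v → not u ∧ v) (∧-identityʳ (odd x)) (disjoint-2^∸1 K L (x / 2) x/2<2^L) ⟩
  not (odd x) ∧ (2^ K ∣ᵇ x / 2)
    ≡⟨ sym (2^suc-∣ᵇ K x) ⟩
  (2^ suc K ∣ᵇ x) ∎
  where
    open ≡-Reasoning
    ones = 2 ^ suc K ∸ 1
    odd-ones : odd ones ≡ true
    odd-ones = trans (cong odd (2^1+K∸1≡1+[2^K∸1]*2 K)) (cong not (odd-*2 (2 ^ K ∸ 1)))
    ones/2 : ones / 2 ≡ 2 ^ K ∸ 1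
    ones/2 = trans (/-congˡ (2^1+K∸1≡1+[2^K∸1]*2 K)) ([m+kn]/n≡k 1 (2 ^ K ∸ 1) 2 (s≤s (s≤s z≤n)))
    x/2<2^L : x / 2 < 2 ^ L
    x/2<2^L = m<n*o⇒m/o<n (subst (x <_) (*-comm 2 (2 ^ L)) x<2^L)

andZero-2^∸1 : ∀ K p → andZero p (2 ^ K ∸ 1) ≡ (2^ K ∣ᵇ p)
andZero-2^∸1 K p = begin
  andZero p (2 ^ K ∸ 1)                           ≡⟨ andFold≡disjoint (suc p) 0 p (2 ^ K ∸ 1) (λ _ → refl) ⟩
  disjoint (suc p) (p >> 0) ((2 ^ K ∸ 1) >> 0)   ≡⟨ cong₂ (disjoint (suc p)) (n/1≡n p) (n/1≡n (2 ^ K ∸ 1)) ⟩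
  disjoint (suc p) p (2 ^ K ∸ 1)                  ≡⟨ disjoint-2^∸1 K (suc p) p (n<2^1+n p) ⟩
  (2^ K ∣ᵇ p) ∎
  where open ≡-Reasoning

2^∣ᵇ-+ : ∀ K j → (2^ K ∣ᵇ 2 ^ K + j) ≡ (2^ K ∣ᵇ j)
2^∣ᵇ-+ K j =
  cong (_≡ᵇ 0) (trans (cong (λ y → _%_ y (2 ^ K) {{nz}}) (+-comm (2 ^ K) j)) ([m+n]%n≡m%n j (2 ^ K) {{nz}}))
  where nz = 2^-nonZero K

2^∣ᵇ-small : ∀ K j → j < 2 ^ K → (2^ K ∣ᵇ j) ≡ (j ≡ᵇ 0)
2^∣ᵇ-small K j j<2^K = cong (_≡ᵇ 0) (m<n⇒m%n≡m {{2^-nonZero K}} j<2^K)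

maskedParity-2^∣ᵇ : ∀ K n → maskedParity (2^ K ∣ᵇ_) (2 ^ K) n ≡ odd n
maskedParity-2^∣ᵇ K n = begin
  maskedParity (2^ K ∣ᵇ_) (2 ^ K) n
    ≡⟨ cong (λ L → maskedParity (2^ K ∣ᵇ_) L n) (sym (m+[n∸m]≡n (m^n>0 2 K))) ⟩
  ((2^ K ∣ᵇ 0) ∧ odd n) xor maskedParity (λ p → 2^ K ∣ᵇ suc p) (2 ^ K ∸ 1) (n / 2)
    ≡⟨ cong₂ (λ b r → (b ∧ odd n) xor r) (2^∣ᵇ-small K 0 (m^n>0 2 K))
             (maskedParity-false _ (2 ^ K ∸ 1) (n / 2) no-positive-multiple) ⟩
  odd n xor false
    ≡⟨ xor-identityʳ (odd n) ⟩
  odd n ∎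
  where
    open ≡-Reasoning
    no-positive-multiple : ∀ p → p < 2 ^ K ∸ 1 → (2^ K ∣ᵇ suc p) ≡ false
    no-positive-multiple p p<e = 2^∣ᵇ-small K (suc p) (subst (suc (suc p) ≤_) (m+[n∸m]≡n (m^n>0 2 K)) (s≤s p<e))

-- Self-similarity of a_m

a-2^∸1≡maskedParity : ∀ K n → a (2 ^ K ∸ 1) n ≡ maskedParity (2^ K ∣ᵇ_) (suc n) n
a-2^∸1≡maskedParity K n =
  trans (a≡maskedParity (2 ^ K ∸ 1) n) (maskedParity-cong (suc n) n (andZero-2^∸1 K))

a-2^∸1-recursion : ∀ K n → a (2 ^ K ∸ 1) n ≡ odd n xor a (2 ^ K ∸ 1) (n >> 2 ^ K)
a-2^∸1-recursion K n = begin
  a (2 ^ K ∸ 1) n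
    ≡⟨ a-2^∸1≡maskedParity K n ⟩
  maskedParity c (suc n) n
    ≡⟨ maskedParity-stable c (suc n) (D + n) n (n<2^1+n n) (<-≤-trans (n<2^n n) (^-monoʳ-≤ 2 (m≤n+m n D))) ⟩
  maskedParity c (D + n) n
    ≡⟨ maskedParity-+ c D n n ⟩
  maskedParity c D n xor maskedParity (λ j → c (D + j)) n q
    ≡⟨ cong₂ _xor_ (maskedParity-2^∣ᵇ K n) (maskedParity-cong n q (2^∣ᵇ-+ K)) ⟩
  odd n xor maskedParity c n q
    ≡⟨ cong (odd n xor_) (maskedParity-stable c n (suc q) q q<2^n (n<2^1+n q)) ⟩
  odd n xor maskedParity c (suc q) q
    ≡⟨ cong (odd n xor_) (sym (a-2^∸1≡maskedParity K q)) ⟩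
  odd n xor a (2 ^ K ∸ 1) q ∎
  where
    open ≡-Reasoning
    D = 2 ^ K
    c = 2^ K ∣ᵇ_
    q = n >> D
    q<2^n : q < 2 ^ n
    q<2^n = ≤-<-trans (m/n≤m n (2 ^ D) {{2^-nonZero D}}) (n<2^n n)

a-zero : ∀ m → a m 0 ≡ false
a-zero m = trans (a≡maskedParity m 0) (cong (_xor false) (∧-zeroʳ (andZero 0 m)))

a-2^∸1-block : ∀ K q r → r < 2 ^ 2 ^ K → a (2 ^ K ∸ 1) (r + q * 2 ^ 2 ^ K) ≡ a (2 ^ K ∸ 1) q xor odd r
a-2^∸1-block K q r r<B = begin
  a m (r + q * B)                          ≡⟨ a-2^∸1-recursion K (r + q * B) ⟩
  odd (r + q * B) xor a m ((r + q * B) >> 2 ^ K)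
    ≡⟨ cong₂ (λ x y → x xor a m y) odd-r+qB ([m+kn]/n≡k r q B {{2^-nonZero (2 ^ K)}} r<B) ⟩
  odd r xor a m q                          ≡⟨ xor-comm (odd r) (a m q) ⟩
  a m q xor odd r                          ∎
  where
    open ≡-Reasoning
    m = 2 ^ K ∸ 1
    B = 2 ^ 2 ^ K
    odd-r+qB : odd (r + q * B) ≡ odd r
    odd-r+qB = trans (odd-+ r (q * B)) (trans (cong (odd r xor_) (odd-*-2^2^ q K)) (xor-identityʳ (odd r)))

-- Alternating words with at most one repeated letter

-- The word b, ¬b, b, … whose letters at positions d − 1 and d are equal; for d ≥ n its prefix
-- of length n alternates throughout.
defectWord : Bool → ℕ → ℕ → Bool
defectWord b d j = b xor (odd j xor does (d ≤? j))

defectWord-before : ∀ b {d} j → j < d → defectWord b d j ≡ b xor odd j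
defectWord-before b {d} j j<d =
  trans (cong (λ f → b xor (odd j xor f)) (dec-false (d ≤? j) (<⇒≱ j<d)))
        (cong (b xor_) (xor-identityʳ (odd j)))

defectWord-after : ∀ b {d} j → d ≤ j → defectWord b d j ≡ b xor not (odd j)
defectWord-after b {d} j d≤j =
  trans (cong (λ f → b xor (odd j xor f)) (dec-true (d ≤? j) d≤j))
        (cong (b xor_) (trans (xor-comm (odd j) true) (true-xor (odd j))))

defectWord-repeats : ∀ b j → defectWord b (suc j) (suc j) ≡ defectWord b (suc j) j
defectWord-repeats b j =
  trans (defectWord-after b (suc j) ≤-refl) (trans (cong (b xor_) (not-involutive (odd j)))
        (sym (defectWord-before b j ≤-refl)))

defectWord-alternates : ∀ b {d} j → suc j ≢ d → defectWord b d (suc j) ≡ not (defectWord b d j)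
defectWord-alternates b {d} j 1+j≢d with d ≤? j
... | yes d≤j = trans (defectWord-after b (suc j) (m≤n⇒m≤1+n d≤j)) (trans (sym (not-distribʳ-xor b (not (odd j))))
                  (cong not (sym (defectWord-after b j d≤j))))
... | no d≰j = trans (defectWord-before b (suc j) 1+j<d) (trans (sym (not-distribʳ-xor b (odd j)))
                  (cong not (sym (defectWord-before b j (≰⇒> d≰j)))))
  where
    1+j<d : suc j < d
    1+j<d = ≤∧≢⇒< (≰⇒> d≰j) 1+j≢d

defectWord-shift : ∀ b e d j → defectWord b (e + d) (e + j) ≡ defectWord (b xor odd e) d j
defectWord-shift b e d j = begin
  b xor (odd (e + j) xor does (e + d ≤? e + j))      ≡⟨ cong₂ (λ x f → b xor (x xor f)) (odd-+ e j) flag ⟩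
  b xor ((odd e xor odd j) xor does (d ≤? j))        ≡⟨ cong (b xor_) (xor-assoc (odd e) (odd j) _) ⟩
  b xor (odd e xor (odd j xor does (d ≤? j)))        ≡⟨ sym (xor-assoc b (odd e) _) ⟩
  (b xor odd e) xor (odd j xor does (d ≤? j))        ∎
  where
    open ≡-Reasoning
    flag : does (e + d ≤? e + j) ≡ does (d ≤? j)
    flag = does-⇔ (mk⇔ (+-cancelˡ-≤ e d j) (+-monoʳ-≤ e)) (e + d ≤? e + j) (d ≤? j)

defectFactor : (n : ℕ) → Bool → ℕ → Vec Bool n
defectFactor n b d = tabulate (λ j → defectWord b d (toℕ j))

defectFactorsFrom : (n : ℕ) → Bool → List (Vec Bool n)
defectFactorsFrom n b = applyUpTo (λ k → defectFactor n b (suc k)) n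

defectFactors : (n : ℕ) → List (Vec Bool n)
defectFactors n = defectFactorsFrom n false ++ defectFactorsFrom n true

length-defectFactors : ∀ n → length (defectFactors n) ≡ 2 * n
length-defectFactors n = begin
  length (defectFactorsFrom n false ++ defectFactorsFrom n true)
    ≡⟨ length-++ (defectFactorsFrom n false) ⟩
  length (defectFactorsFrom n false) + length (defectFactorsFrom n true)
    ≡⟨ cong₂ _+_ (length-applyUpTo _ n) (length-applyUpTo _ n) ⟩
  n + n
    ≡⟨ cong (n +_) (sym (+-identityʳ n)) ⟩
  2 * n ∎
  where open ≡-Reasoning

defectFactorsFrom-unique : ∀ n b → Unique (defectFactorsFrom n b)
defectFactorsFrom-unique n b = applyUpTo⁺₁ _ n distinct
  where
    distinct : ∀ {i j} → i < j → j < n → defectFactor n b (suc i) ≢ defectFactor n b (suc j)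
    distinct {i} {j} i<j j<n eq = not-¬ refl (begin
      b xor odd (suc i)                         ≡⟨ sym (defectWord-before b (suc i) (s<s i<j)) ⟩
      defectWord b (suc j) (suc i)              ≡⟨ sym (letter (suc j)) ⟩
      lookup (defectFactor n b (suc j)) k       ≡⟨ cong (λ v → lookup v k) (sym eq) ⟩
      lookup (defectFactor n b (suc i)) k       ≡⟨ letter (suc i) ⟩
      defectWord b (suc i) (suc i)              ≡⟨ defectWord-after b (suc i) ≤-refl ⟩
      b xor not (odd (suc i))                   ≡⟨ sym (not-distribʳ-xor b (odd (suc i))) ⟩
      not (b xor odd (suc i))                   ∎)
      where
        open ≡-Reasoning
        1+i<n = <-≤-trans (s<s i<j) j<n
        k = fromℕ< 1+i<n
        letter : ∀ d → lookup (defectFactor n b d) k ≡ defectWord b d (suc i)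
        letter d = trans (lookup∘tabulate _ k) (cong (defectWord b d) (toℕ-fromℕ< 1+i<n))

defectFactorsFrom-disjoint : ∀ n → Disjoint (defectFactorsFrom n false) (defectFactorsFrom n true)
defectFactorsFrom-disjoint zero (() , _)
defectFactorsFrom-disjoint (suc n) (v∈false , v∈true)
  with ∈-applyUpTo⁻ (λ k → defectFactor (suc n) false (suc k)) v∈false
     | ∈-applyUpTo⁻ (λ k → defectFactor (suc n) true (suc k)) v∈true
... | k , _ , refl | k' , _ , eq =
  not-¬ refl (trans (sym (first-letter false k)) (trans (cong head eq) (first-letter true k')))
  where
    first-letter : ∀ b k → head (defectFactor (suc n) b (suc k)) ≡ b
    first-letter b k = trans (defectWord-before b {suc k} 0 z<s) (xor-identityʳ b)

defectFactors-unique : ∀ n → Unique (defectFactors n)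
defectFactors-unique n =
  ++⁺ (defectFactorsFrom-unique n false) (defectFactorsFrom-unique n true) (defectFactorsFrom-disjoint n)

∈-defectFactors⁺ : ∀ n b {k} → k < n → defectFactor n b (suc k) ∈ defectFactors n
∈-defectFactors⁺ n false k<n = ∈-++⁺ˡ (∈-applyUpTo⁺ _ k<n)
∈-defectFactors⁺ n true k<n = ∈-++⁺ʳ (defectFactorsFrom n false) (∈-applyUpTo⁺ _ k<n)

∈-defectFactors⁻ : ∀ n {v} → v ∈ defectFactors n → ∃₂ λ b k → k < n × v ≡ defectFactor n b (suc k)
∈-defectFactors⁻ n v∈ with ∈-++⁻ (defectFactorsFrom n false) v∈
... | inj₁ v∈false = let k , k<n , v≡ = ∈-applyUpTo⁻ _ v∈false in false , k , k<n , v≡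
... | inj₂ v∈true = let k , k<n , v≡ = ∈-applyUpTo⁻ _ v∈true in true , k , k<n , v≡

-- Factors of self-similar words

module SelfSimilarWord (B : ℕ) (B-even : odd B ≡ false) (3≤B : 3 ≤ B)
  (w : ℕ → Bool) (w-zero : w 0 ≡ false)
  (w-block : ∀ q r → r < B → w (r + q * B) ≡ w q xor odd r) where

  instance
    B-nonZero : NonZero B
    B-nonZero = >-nonZero (≤-trans (s≤s z≤n) 3≤B)

  w-one : w 1 ≡ true
  w-one = trans (w-block 0 1 (≤-trans (s≤s (s≤s z≤n)) 3≤B)) (cong (_xor true) w-zero)

  w-two : w 2 ≡ false
  w-two = trans (w-block 0 2 3≤B) (cong (_xor false) w-zero)

  1+[B∸1]≡B : suc (B ∸ 1) ≡ B
  1+[B∸1]≡B = m+[n∸m]≡n (≤-trans (s≤s z≤n) 3≤B)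

  w-B∸1 : w (B ∸ 1) ≡ true
  w-B∸1 = begin
    w (B ∸ 1)                   ≡⟨ cong w (sym (+-identityʳ (B ∸ 1))) ⟩
    w (B ∸ 1 + 0 * B)           ≡⟨ w-block 0 (B ∸ 1) (subst (B ∸ 1 <_) 1+[B∸1]≡B ≤-refl) ⟩
    w 0 xor odd (B ∸ 1)         ≡⟨ cong₂ _xor_ w-zero odd-B∸1 ⟩
    true                        ∎
    where
      open ≡-Reasoning
      odd-B∸1 : odd (B ∸ 1) ≡ true
      odd-B∸1 = trans (sym (not-involutive (odd (B ∸ 1)))) (cong not (trans (cong odd 1+[B∸1]≡B) B-even))

  w-B : w B ≡ w 1
  w-B = trans (cong w (sym (+-identityʳ B))) (trans (w-block 1 0 (≤-trans z<s 3≤B)) (xor-identityʳ (w 1)))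

  w-next-block : ∀ q t → B ≤ t → t < 2 * B → w (t + q * B) ≡ w (suc q) xor odd t
  w-next-block q t B≤t t<2B = begin
    w (t + q * B)               ≡⟨ cong w t+qB≡ ⟩
    w ((t ∸ B) + suc q * B)     ≡⟨ w-block (suc q) (t ∸ B) t∸B<B ⟩
    w (suc q) xor odd (t ∸ B)   ≡⟨ cong (w (suc q) xor_) odd-t∸B ⟩
    w (suc q) xor odd t         ∎
    where
      open ≡-Reasoning
      t+qB≡ : t + q * B ≡ (t ∸ B) + (B + q * B)
      t+qB≡ = trans (cong (_+ q * B) (sym (m∸n+n≡m B≤t))) (+-assoc (t ∸ B) B (q * B))
      t∸B<B : t ∸ B < B
      t∸B<B = subst (t ∸ B <_) (trans (cong (λ x → B + x ∸ B) (+-identityʳ B)) (m+n∸m≡n B B))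
                    (∸-monoˡ-< t<2B B≤t)
      odd-t∸B : odd (t ∸ B) ≡ odd t
      odd-t∸B = begin
        odd (t ∸ B)               ≡⟨ sym (xor-identityʳ (odd (t ∸ B))) ⟩
        odd (t ∸ B) xor false     ≡⟨ cong (odd (t ∸ B) xor_) (sym B-even) ⟩
        odd (t ∸ B) xor odd B     ≡⟨ sym (odd-+ (t ∸ B) B) ⟩
        odd (t ∸ B + B)           ≡⟨ cong odd (m∸n+n≡m B≤t) ⟩
        odd t                     ∎

  alternating-across : ∀ q t → w (suc q) ≡ w q → t < 2 * B → w (t + q * B) ≡ w q xor odd t
  alternating-across q t same t<2B with t <? B
  ... | yes t<B = w-block q t t<B
  ... | no t≮B = trans (w-next-block q t (≮⇒≥ t≮B) t<2B) (cong (_xor odd t) same)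

  repeat-across : ∀ q t → w (suc q) ≡ not (w q) → t < 2 * B → w (t + q * B) ≡ defectWord (w q) B t
  repeat-across q t flip t<2B with t <? B
  ... | yes t<B = trans (w-block q t t<B) (sym (defectWord-before (w q) t t<B))
  ... | no t≮B = begin
    w (t + q * B)             ≡⟨ w-next-block q t (≮⇒≥ t≮B) t<2B ⟩
    w (suc q) xor odd t       ≡⟨ cong (_xor odd t) flip ⟩
    not (w q) xor odd t       ≡⟨ sym (not-distribˡ-xor (w q) (odd t)) ⟩
    not (w q xor odd t)       ≡⟨ not-distribʳ-xor (w q) (odd t) ⟩
    w q xor not (odd t)       ≡⟨ sym (defectWord-after (w q) t (≮⇒≥ t≮B)) ⟩
    defectWord (w q) B t      ∎
    where open ≡-Reasoning

  repeat⇒B∣ : ∀ k → w (suc k) ≡ w k → B ∣ suc k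
  repeat⇒B∣ k repeat with suc (k % B) <? B
  ... | yes 1+r<B = contradiction (trans (sym repeat) alternates) (not-¬ refl)
    where
      alternates : w (suc k) ≡ not (w k)
      alternates = begin
        w (suc k)                          ≡⟨ cong w (cong suc (m≡m%n+[m/n]*n k B)) ⟩
        w (suc (k % B) + k / B * B)        ≡⟨ w-block (k / B) (suc (k % B)) 1+r<B ⟩
        w (k / B) xor not (odd (k % B))    ≡⟨ sym (not-distribʳ-xor (w (k / B)) (odd (k % B))) ⟩
        not (w (k / B) xor odd (k % B))    ≡⟨ cong not (sym (w-block (k / B) (k % B) (m%n<n k B))) ⟩
        not (w (k % B + k / B * B))        ≡⟨ cong (λ x → not (w x)) (sym (m≡m%n+[m/n]*n k B)) ⟩
        not (w k)                          ∎
        where open ≡-Reasoning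
  ... | no 1+r≮B = divides (suc (k / B)) (trans (cong suc (m≡m%n+[m/n]*n k B)) (cong (_+ k / B * B) 1+r≡B))
    where
      1+r≡B : suc (k % B) ≡ B
      1+r≡B = ≤-antisym (m%n<n k B) (≮⇒≥ 1+r≮B)

  repeats-far-apart : ∀ {k l} → w (suc k) ≡ w k → w (suc l) ≡ w l → k < l → B + k ≤ l
  repeats-far-apart {k} {l} repeat-k repeat-l k<l =
    s≤s⁻¹ (subst (_≤ suc l) (+-suc B k) (∣-gap (repeat⇒B∣ k repeat-k) (repeat⇒B∣ l repeat-l) (s<s k<l)))

  Window : ℕ → ℕ → Bool → ℕ → Set
  Window i n b d = ∀ j → j < n → w (i + j) ≡ defectWord b d j

  window⇒factor : ∀ {i n} b d → Window i n b d → factor w i n ≡ defectFactor n b d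
  window⇒factor b d window = tabulate-cong (λ j → window (toℕ j) (toℕ<n j))

  window-extend : ∀ {i n} b d → Window i n b d → w (i + n) ≡ defectWord b d n → Window i (suc n) b d
  window-extend b d window last j j<1+n with m<1+n⇒m<n∨m≡n j<1+n
  ... | inj₁ j<n = window j j<n
  ... | inj₂ refl = last

  no-second-repeat : ∀ {i n k} → n < B → k < n → Window i (suc n) (w i) (suc k) → w (i + suc n) ≢ w (i + n)
  no-second-repeat {i} {n} {k} n<B k<n window repeat-n =
    <⇒≱ too-close (repeats-far-apart repeat-k (at-suc repeat-n) (+-monoʳ-< i k<n))
    where
      at-suc : ∀ {m} → w (i + suc m) ≡ w (i + m) → w (suc (i + m)) ≡ w (i + m)
      at-suc {m} = trans (cong w (sym (+-suc i m)))
      repeat-k : w (suc (i + k)) ≡ w (i + k)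
      repeat-k = at-suc (begin
        w (i + suc k)                      ≡⟨ window (suc k) (s<s k<n) ⟩
        defectWord (w i) (suc k) (suc k)   ≡⟨ defectWord-repeats (w i) k ⟩
        defectWord (w i) (suc k) k         ≡⟨ sym (window k (m≤n⇒m≤1+n k<n)) ⟩
        w (i + k)                          ∎)
        where open ≡-Reasoning
      too-close : i + n < B + (i + k)
      too-close = <-≤-trans (+-monoʳ-< i n<B) (≤-trans (≤-reflexive (+-comm i B)) (+-monoʳ-≤ B (m≤m+n i k)))

  window-shape-suc : ∀ {i n k} → suc n ≤ B → k ≤ n → Window i (suc n) (w i) (suc k) →
                     ∃ λ k' → k' ≤ suc n × Window i (suc (suc n)) (w i) (suc k')
  window-shape-suc {i} {n} {k} 1+n≤B k≤n window with m≤n⇒m<n∨m≡n k≤n | w (i + suc n) ≟ᵇ w (i + n)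
  ... | inj₁ k<n | yes repeat = contradiction repeat (no-second-repeat 1+n≤B k<n window)
  ... | inj₁ k<n | no alternation = k , m≤n⇒m≤1+n k≤n , window-extend (w i) (suc k) window (begin
    w (i + suc n)                      ≡⟨ ¬-not alternation ⟩
    not (w (i + n))                    ≡⟨ cong not (window n ≤-refl) ⟩
    not (defectWord (w i) (suc k) n)   ≡⟨ sym (defectWord-alternates (w i) n (<⇒≢ (s<s k<n) ∘ sym)) ⟩
    defectWord (w i) (suc k) (suc n)   ∎)
    where open ≡-Reasoning
  ... | inj₂ refl | yes repeat = k , n≤1+n k , window-extend (w i) (suc k) window (begin
    w (i + suc k)                      ≡⟨ repeat ⟩
    w (i + k)                          ≡⟨ window k ≤-refl ⟩
    defectWord (w i) (suc k) k         ≡⟨ sym (defectWord-repeats (w i) k) ⟩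
    defectWord (w i) (suc k) (suc k)   ∎)
    where open ≡-Reasoning
  ... | inj₂ refl | no alternation = suc k , ≤-refl , window-extend (w i) (suc (suc k)) prefix (begin
    w (i + suc k)                            ≡⟨ ¬-not alternation ⟩
    not (w (i + k))                          ≡⟨ cong not (prefix k ≤-refl) ⟩
    not (defectWord (w i) (suc (suc k)) k)   ≡⟨ sym (defectWord-alternates (w i) k (<⇒≢ ≤-refl)) ⟩
    defectWord (w i) (suc (suc k)) (suc k)   ∎)
    where
      open ≡-Reasoning
      prefix : Window i (suc k) (w i) (suc (suc k))
      prefix j j<1+k = trans (window j j<1+k)
        (trans (defectWord-before (w i) j j<1+k) (sym (defectWord-before (w i) j (m≤n⇒m≤1+n j<1+k))))

  window-shape : ∀ n i → n ≤ B → ∃ λ k → k ≤ n × Window i (suc n) (w i) (suc k)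
  window-shape zero i _ = 0 , z≤n , λ where
    zero _ → trans (cong w (+-identityʳ i)) (sym (xor-identityʳ (w i)))
    (suc j) (s<s ())
  window-shape (suc n) i 1+n≤B with window-shape n i (≤-trans (n≤1+n n) 1+n≤B)
  ... | k , k≤n , window = window-shape-suc 1+n≤B k≤n window

  repeat-boundary : ∀ x → ∃ λ q → w q ≡ x × w (suc q) ≡ not (w q)
  repeat-boundary false = 0 , w-zero , trans w-one (cong not (sym w-zero))
  repeat-boundary true = 1 , w-one , trans w-two (cong not (sym w-one))

  -- The window starts d letters before the repeat at the boundary after block q.
  repeat-window : ∀ n b k → suc k < n → n ≤ suc B → ∃ λ i → Window i n b (suc k)
  repeat-window n b k 1+k<n n≤1+B with repeat-boundary (b xor odd (B ∸ suc k))
  ... | q , wq≡ , flip = e + q * B , window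
    where
      d = suc k
      e = B ∸ d
      e+d≡B : e + d ≡ B
      e+d≡B = m∸n+n≡m (s≤s⁻¹ (<-≤-trans 1+k<n n≤1+B))
      e+j<2B : ∀ j → j < n → e + j < 2 * B
      e+j<2B j j<n = begin-strict
        e + j         <⟨ +-monoʳ-< e (<-≤-trans j<n (≤-trans n≤1+B (+-monoˡ-≤ B (s≤s z≤n)))) ⟩
        e + (d + B)   ≡⟨ sym (+-assoc e d B) ⟩
        e + d + B     ≡⟨ cong (_+ B) e+d≡B ⟩
        B + B         ≡⟨ cong (B +_) (sym (+-identityʳ B)) ⟩
        2 * B         ∎
        where open ≤-Reasoning
      window : Window (e + q * B) n b d
      window j j<n = begin
        w (e + q * B + j)                  ≡⟨ cong w (xy∙z≈xz∙y e (q * B) j) ⟩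
        w (e + j + q * B)                  ≡⟨ repeat-across q (e + j) flip (e+j<2B j j<n) ⟩
        defectWord (w q) B (e + j)         ≡⟨ cong (λ x → defectWord (w q) x (e + j)) (sym e+d≡B) ⟩
        defectWord (w q) (e + d) (e + j)   ≡⟨ defectWord-shift (w q) e d j ⟩
        defectWord (w q xor odd e) d j     ≡⟨ cong (λ x → defectWord (x xor odd e) d j) wq≡ ⟩
        defectWord ((b xor odd e) xor odd e) d j ≡⟨ cong (λ x → defectWord x d j) (xor-cancelʳ b (odd e)) ⟩
        defectWord b d j                   ∎
        where open ≡-Reasoning

  -- Blocks B − 1 and B both start with true, so the letters from (B − 1)B to (B + 1)B alternate.
  alternating-window : ∀ n b → n ≤ suc B → ∃ λ i → Window i n b n
  alternating-window n b n≤1+B = offset b + (B ∸ 1) * B , window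
    where
      open ≡-Reasoning
      offset : Bool → ℕ
      offset true = 0
      offset false = 1
      offset≤1 : ∀ b → offset b ≤ 1
      offset≤1 true = z≤n
      offset≤1 false = ≤-refl
      not-odd-offset : ∀ b → not (odd (offset b)) ≡ b
      not-odd-offset true = refl
      not-odd-offset false = refl
      same : w (suc (B ∸ 1)) ≡ w (B ∸ 1)
      same = trans (cong w 1+[B∸1]≡B) (trans w-B (trans w-one (sym w-B∸1)))
      e = offset b
      e+j<2B : ∀ j → j < n → e + j < 2 * B
      e+j<2B j j<n = <-≤-trans (+-mono-≤-< (offset≤1 b) (<-≤-trans j<n n≤1+B))
                               (subst (2 + B ≤_) (cong (B +_) (sym (+-identityʳ B)))
                                      (+-monoˡ-≤ B (≤-trans (s≤s (s≤s z≤n)) 3≤B)))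
      window : Window (e + (B ∸ 1) * B) n b n
      window j j<n = begin
        w (e + (B ∸ 1) * B + j)              ≡⟨ cong w (xy∙z≈xz∙y e ((B ∸ 1) * B) j) ⟩
        w (e + j + (B ∸ 1) * B)              ≡⟨ alternating-across (B ∸ 1) (e + j) same (e+j<2B j j<n) ⟩
        w (B ∸ 1) xor odd (e + j)            ≡⟨ cong₂ _xor_ w-B∸1 (odd-+ e j) ⟩
        true xor (odd e xor odd j)           ≡⟨ sym (xor-assoc true (odd e) (odd j)) ⟩
        not (odd e) xor odd j                ≡⟨ cong (_xor odd j) (not-odd-offset b) ⟩
        b xor odd j                          ≡⟨ sym (defectWord-before b j j<n) ⟩
        defectWord b n j                     ∎

  defectFactor-occurs : ∀ n b k → k < n → n ≤ suc B → ∃ λ i → factor w i n ≡ defectFactor n b (suc k)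
  defectFactor-occurs n b k k<n n≤1+B with m≤n⇒m<n∨m≡n k<n
  ... | inj₁ 1+k<n = map₂ (window⇒factor b (suc k)) (repeat-window n b k 1+k<n n≤1+B)
  ... | inj₂ refl = map₂ (window⇒factor b (suc k)) (alternating-window (suc k) b n≤1+B)

  factorComplexity : ∀ n → 1 ≤ n → n ≤ suc B → FactorComplexity w n (2 * n)
  factorComplexity (suc n) _ 1+n≤1+B =
    defectFactors (suc n) , defectFactors-unique (suc n) , length-defectFactors (suc n) ,
    λ v → mk⇔ (occurs v) (listed v)
    where
      occurs : ∀ v → v ∈ defectFactors (suc n) → ∃ λ i → factor w i (suc n) ≡ v
      occurs v v∈ with ∈-defectFactors⁻ (suc n) v∈
      ... | b , k , k<1+n , refl = defectFactor-occurs (suc n) b k k<1+n 1+n≤1+B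
      listed : ∀ v → (∃ λ i → factor w i (suc n) ≡ v) → v ∈ defectFactors (suc n)
      listed v (i , refl) with window-shape n i (s≤s⁻¹ 1+n≤1+B)
      ... | k , k≤n , window = subst (_∈ defectFactors (suc n)) (sym (window⇒factor (w i) (suc k) window))
                                     (∈-defectFactors⁺ (suc n) (w i) (s≤s k≤n))

theorem41 : (K n : ℕ) → 1 ≤ K → 1 ≤ n → n ≤ 2 ^ (2 ^ K) + 1 →
    FactorComplexity (a (2 ^ K ∸ 1)) n (2 * n)
theorem41 K n 1≤K 1≤n n≤B+1 = factorComplexity n 1≤n (subst (n ≤_) (+-comm (2 ^ 2 ^ K) 1) n≤B+1)
  where
    B-even : odd (2 ^ 2 ^ K) ≡ false
    B-even = trans (cong odd (sym (*-identityˡ (2 ^ 2 ^ K)))) (odd-*-2^2^ 1 K)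
    3≤B : 3 ≤ 2 ^ 2 ^ K
    3≤B = ≤-trans (n≤1+n 3) (^-monoʳ-≤ 2 (^-monoʳ-≤ 2 1≤K))
    open SelfSimilarWord (2 ^ 2 ^ K) B-even 3≤B (a (2 ^ K ∸ 1)) (a-zero (2 ^ K ∸ 1)) (a-2^∸1-block K)
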